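{- Let $\mathcal M$ be a P-matroid of rank $n$ on $[2n]$ and let $\widehat{\mathcal M}$ be an extension of $\mathcal M$ to $[2n+1]$ that is nondegenerate. Then: (1) for every oriented matroid $\mathcal N$ that is C-equivalent to $\mathcal M$, there exists an extension of $\mathcal N$ to $[2n+1]$ inducing an orientation of the $n$-cube that is isomorphic to the orientation induced by $\widehat{\mathcal M}$; (2) for every oriented matroid $\mathcal N$ that is FS-equivalent to $\mathcal M$, there exists an extension of $\mathcal N$ to $[2n+1]$ inducing an orientation of the $n$-cube that can be transformed into the orientation induced by $\widehat{\mathcal M}$ by successive facet switches.
   Context: Oriented matroids (chirotope form): a chirotope of rank $r$ on a finite set $E$ is a map $\chi:E^r\to\{+,-,0\}$ that is not identically zero, is alternating, and satisfies: for all $i_1,\dots,i_r,j_1,\dots,j_r\in E$, if $\chi(j_s,i_2,\dots,i_r)\chi(j_1,\dots,j_{s-1},i_1,j_{s+1},\dots,j_r)\ge 0$ for all $s\in[r]$ then $\chi(i_1,\dots,i_r)\chi(j_1,\dots,j_r)\ge0$. An oriented matroid is $\mathcal M=(E,\{\chi,-\chi\})$. Restriction to $F\subseteq E$ is $(F,\{\chi|_F,-\chi|_F\})$; an extension of a rank-$r$ oriented matroid on $E$ is a rank-$r$ oriented matroid on $E\cup\{p\}$, $p\notin E$, whose restriction to $E$ is the original one. For a permutation $\sigma$ of $E$, $\sigma\cdot\mathcal M$ has chirotope $(i_1,\dots,i_r)\mapsto\chi(\sigma(i_1),\dots,\sigma(i_r))$; for $A\subseteq E$, ${}_{ -A}\mathcal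 M$ has chirotope $(i_1,\dots,i_r)\mapsto(-1)^{|A\cap\{i_1,\dots,i_r\}|}\chi(i_1,\dots,i_r)$. On $[2n]$ write $\bar i=i+n$, $\overline{i+n}=i$ for $i\in[n]$, $\bar A=\{\bar i:i\in A\}$. A P-matroid is a rank-$n$ oriented matroid on $[2n]$ with chirotope $\chi$ such that $\chi(b_1,\dots,b_{i-1},i,b_{i+1},\dots,b_n)=-\chi(b_1,\dots,b_{i-1},\bar i,b_{i+1},\dots,b_n)\neq0$ for all $(b_1,\dots,b_n)\in\{1,\bar1\}\times\dots\times\{n,\bar n\}$, $i\in[n]$. $\mathcal N$ is C-equivalent to $\mathcal M$ if $\mathcal N=\sigma\cdot\mathcal M$ for a permutation $\sigma$ of $[2n]$ with $\sigma(\bar i)=\overline{\sigma(i)}$ for all $i$; FS-equivalent if $\mathcal N={}_{ -A}\mathcal M$ for some $A\subseteq[2n]$ with $\bar A=A$. An extension $\widehat{\mathcal M}=([2n+1],\{\hat\chi,-\hat\chi\})$ of a P-matroid is nondegenerate if $\hat\chi(b_1,\dots,b_{i-1},2n+1,b_{i+1},\dots,b_n)\ne0$ for all such $(b_1,\dots,b_n)$ and $i$. The $n$-cube has vertices the subsets of $[n]$, $B,C$ adjacent iff $|B\oplus C|=1$. For $B\subseteq[n]$ let $b_j=j+n$ if $j\in B$, $b_j=j$ otherwise; the induced orientation orients $\{B,B\oplus\{i\}\}$ from $B$ to $B\oplus\{i\}$ iff $\hat\chi(b_1,\dots,b_n)\hat\chi(b_1,\dots,b_{i-1},2n+1,b_{i+1},\dots,b_n)=-$.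 Two orientations of the $n$-cube are isomorphic if a graph automorphism of the $n$-cube maps one to the other. A facet switch of an orientation of the $n$-cube is the operation, for some $i\in[n]$, of reversing all edges $\{B,B\oplus\{i\}\}$ (the edges joining the two opposite facets $\{B: i\notin B\}$ and $\{B: i\in B\}$). -}

module Defs where

open import Data.Nat using (ℕ; zero; suc; _+_)
open import Data.Bool using (Bool; true; false; if_then_else_; not)
open import Data.Fin using (Fin; zero; suc; _↑ˡ_; _↑ʳ_; splitAt; fromℕ; inject₁)
open import Data.Fin.Permutation using (Permutation′; _⟨$⟩ʳ_)
open import Data.Vec using (Vec; lookup; _[_]≔_; tabulate; map; foldr)
open import Data.Sum using (_⊎_; inj₁; inj₂)
open import Data.Product using (Σ; ∃; _×_; _,_)
open import Data.List using (List; []; _∷_)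
open import Data.Unit using (⊤)
open import Relation.Binary.PropositionalEquality using (_≡_; _≢_)
open import Function.Bundles using (_⇔_; _↔_; Inverse)

data Sign : Set where
  plus minus zer : Sign

neg : Sign → Sign
neg plus  = minus
neg minus = plus
neg zer   = zer

infixl 7 _·_
_·_ : Sign → Sign → Sign
zer   · _ = zer
plus  · s = s
minus · s = neg s

NonNeg : Sign → Set
NonNeg s = s ≢ minus

Chi : ℕ → ℕ → Set
Chi m r = Vec (Fin m) r → Sign

swapPos : ∀ {A : Set} {r} → Vec A r → Fin r → Fin r → Vec A r
swapPos v s t = (v [ s ]≔ lookup v t) [ t ]≔ lookup v s

NotIdZero : ∀ {m r} → Chi m r → Set
NotIdZero χ = ∃ λ v → χ v ≢ zer

Alternating : ∀ {m r} → Chi m r → Set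
Alternating {r = r} χ = ∀ v (s t : Fin r) → s ≢ t → χ (swapPos v s t) ≡ neg (χ v)

-- Grassmann–Plücker axiom (vacuous in rank 0, where there is no i₁)
GP : ∀ {m} r → Chi m r → Set
GP zero    χ = ⊤
GP (suc k) χ = ∀ (i j : Vec _ (suc k)) →
  (∀ s → NonNeg (χ (i [ zero ]≔ lookup j s) · χ (j [ s ]≔ lookup i zero))) →
  NonNeg (χ i · χ j)

record IsChirotope {m r} (χ : Chi m r) : Set where
  field
    notIdZero   : NotIdZero χ
    alternating : Alternating χ
    gp          : GP r χ

SameOM : ∀ {m r} → Chi m r → Chi m r → Set
SameOM χ ψ = (∀ v → χ v ≡ ψ v) ⊎ (∀ v → χ v ≡ neg (ψ v))

-- Ground set [2n] = Fin (n + n): i ∈ [n] is  i ↑ˡ n,  ī = i + n is  n ↑ʳ i.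
-- [2n+1] = Fin (suc (n + n)): old elements via inject₁, new element 2n+1 is fromℕ (n + n).

bar : ∀ {n} → Fin (n + n) → Fin (n + n)
bar {n} x with splitAt n x
... | inj₁ i = n ↑ʳ i
... | inj₂ i = i ↑ˡ n

Extends : ∀ {n r} → Chi (suc (n + n)) r → Chi (n + n) r → Set
Extends χ̂ χ = SameOM (λ v → χ̂ (map inject₁ v)) χ

newElt : ∀ n → Fin (suc (n + n))
newElt n = fromℕ (n + n)

Vertex : ℕ → Set
Vertex n = Vec Bool n

cobase : ∀ {n} → Vertex n → Vec (Fin (n + n)) n
cobase {n} B = tabulate λ j → if lookup B j then n ↑ʳ j else j ↑ˡ n

IsPMatroid : ∀ {n} → Chi (n + n) n → Set
IsPMatroid {n} χ = IsChirotope χ ×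
  (∀ (B : Vertex n) (i : Fin n) →
     (χ (cobase B [ i ]≔ (i ↑ˡ n)) ≡ neg (χ (cobase B [ i ]≔ (n ↑ʳ i))))
     × (χ (cobase B [ i ]≔ (n ↑ʳ i)) ≢ zer))

BarCompatible : ∀ {n} → Permutation′ (n + n) → Set
BarCompatible {n} σ = ∀ x → σ ⟨$⟩ʳ bar {n} x ≡ bar {n} (σ ⟨$⟩ʳ x)

permute : ∀ {m r} → Permutation′ m → Chi m r → Chi m r
permute σ χ v = χ (map (σ ⟨$⟩ʳ_) v)

reorient : ∀ {m r} → (Fin m → Bool) → Chi m r → Chi m r
reorient A χ v = foldr _ (λ b s → if b then neg s else s) (χ v) (map A v)

CEquivalent : ∀ {n} → Chi (n + n) n → Chi (n + n) n → Set
CEquivalent {n} ψ χ = Σ (Permutation′ (n + n)) λ σ → BarCompatible {n} σ × SameOM ψ (permute σ χ)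

FSEquivalent : ∀ {n} → Chi (n + n) n → Chi (n + n) n → Set
FSEquivalent {n} ψ χ = Σ (Fin (n + n) → Bool) λ A → (∀ x → A (bar {n} x) ≡ A x) × SameOM ψ (reorient A χ)

Nondegenerate : ∀ {n} → Chi (suc (n + n)) n → Set
Nondegenerate {n} χ̂ = ∀ (B : Vertex n) (i : Fin n) →
  χ̂ (map inject₁ (cobase B) [ i ]≔ newElt n) ≢ zer

flipAt : ∀ {n} → Vertex n → Fin n → Vertex n
flipAt B i = B [ i ]≔ not (lookup B i)

Adj : ∀ {n} → Vertex n → Vertex n → Set
Adj B C = ∃ λ i → C ≡ flipAt B i

Orientation : ℕ → Set₁
Orientation n = Vertex n → Vertex n → Set

induced : ∀ {n} → Chi (suc (n + n)) n → Orientation n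
induced {n} χ̂ B C = ∃ λ i → C ≡ flipAt B i ×
  (χ̂ (map inject₁ (cobase B)) · χ̂ (map inject₁ (cobase B) [ i ]≔ newElt n) ≡ minus)

record CubeAutomorphism (n : ℕ) : Set where
  field
    bij      : Vertex n ↔ Vertex n
    adjacent : ∀ B C → Adj B C ⇔ Adj (Inverse.to bij B) (Inverse.to bij C)

Isomorphic : ∀ {n} → Orientation n → Orientation n → Set
Isomorphic {n} O₁ O₂ = Σ (CubeAutomorphism n) λ φ →
  ∀ B C → O₁ B C ⇔ O₂ (Inverse.to (CubeAutomorphism.bij φ) B) (Inverse.to (CubeAutomorphism.bij φ) C)

facetSwitch : ∀ {n} → Fin n → Orientation n → Orientation n
facetSwitch i O B C = (C ≡ flipAt B i × O C B) ⊎ (C ≢ flipAt B i × O B C)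

facetSwitches : ∀ {n} → List (Fin n) → Orientation n → Orientation n
facetSwitches []       O = O
facetSwitches (i ∷ is) O = facetSwitch i (facetSwitches is O)

SameOrientation : ∀ {n} → Orientation n → Orientation n → Set
SameOrientation O₁ O₂ = ∀ B C → O₁ B C ⇔ O₂ B C

-- Identify a vertex B of the n-cube with its complementary basis
-- b = (b₁,…,bₙ) of [2n], and let e(B,i) = χ̂(b)·χ̂(b with bᵢ := 2n+1) be the
-- sign of the edge {B, B ⊕ {i}} seen from B: the induced orientation has
-- the arc B → B ⊕ {i} exactly when e(B,i) = −.
--
-- (1) A bar-compatible permutation σ of [2n] maps each pair {j, j̄} onto a
--     pair {π j, π j̄}, so it acts on the cube as a signed permutation φ of
--     the coordinates.  Extend σ to [2n+1] by fixing 2n+1: then σ̂·M̂ extends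
--     σ·M, and σ̂ maps the basis of B onto that of φ(B) up to the permutation
--     π of positions, which changes χ̂ by one fixed sign.  Hence the edge
--     signs of σ̂·M̂ are those of M̂ transported along φ.
-- (2) For a bar-symmetric set A ⊆ [2n], reorienting M̂ on A (not on 2n+1)
--     extends _{-A}M and multiplies e(B,i) by −1 exactly when i ∈ A.  In a
--     P-matroid the two endpoints of an edge see opposite signs, so this
--     reverses exactly the edges in the directions i ∈ A, as do the facet
--     switches in those directions.
module Submission where

open import Defs
open import Data.Nat using (ℕ; suc; _+_)
open import Data.Product using (Σ; _×_)
open import Data.List using (List)
open import Data.Fin using (Fin)

open import Data.Nat using (zero)
open import Data.Bool using (Bool; true; false; not; _xor_; if_then_else_)
open import Data.Bool.Properties
  using (not-involutive; not-¬; xor-same; xor-comm; xor-assoc; xor-identityʳ; not-distribˡ-xor; xor-∧-commutativeRing)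
open import Data.Fin using (zero; suc; _↑ˡ_; _↑ʳ_; splitAt; join; fromℕ; inject₁)
open import Data.Fin.Properties using (_≟_; splitAt-↑ˡ; splitAt-↑ʳ; join-splitAt)
open import Data.Fin.Relation.Unary.Top using (View; view; ‵fromℕ; ‵inj₁; view-fromℕ; view-inject₁)
open import Data.Fin.Permutation as Perm using (Permutation′; _⟨$⟩ʳ_; _⟨$⟩ˡ_; inverseˡ; inverseʳ)
import Data.Fin.Permutation.Components as PC
open import Data.Fin.Permutation.Transposition.List using (TranspositionList; eval; decompose; eval-decompose)
open import Data.List using ([]; _∷_)
open import Data.Vec using (Vec; []; _∷_; lookup; _[_]≔_; tabulate; map; foldr)
open import Data.Vec.Properties
  using (lookup-map; map-[]≔; lookup∘update; lookup∘update′; lookup∘tabulate; []≔-lookup; []≔-idempotent;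
         map-∘; map-cong; map-id; tabulate∘lookup; tabulate-cong)
import Data.List as List
open import Data.Empty using (⊥-elim)
open import Data.Sum using (inj₁; inj₂; [_,_]′)
open import Data.Product using (_,_; proj₁; proj₂; ∃)
open import Relation.Nullary using (yes; no; does)
open import Relation.Nullary.Decidable using (dec-true; dec-false)
open import Relation.Binary.PropositionalEquality
  using (_≡_; _≢_; refl; sym; trans; cong; cong₂; subst; module ≡-Reasoning)
open import Function.Bundles using (_⇔_; Equivalence; mk⇔; mk↔ₛ′)
open import Function.Construct.Identity using (⇔-id)
open import Function.Construct.Composition using (_⇔-∘_)
open import Algebra.Bundles using (CommutativeRing)
import Algebra.Properties.CommutativeSemigroup as CommutativeSemigroupProperties

-- Sign arithmetic.  Signs ±1 are indexed by parity bits: `sgn true · s`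
-- is `neg s` by definition, and products of parities become xors.

sgn : Bool → Sign
sgn false = plus
sgn true  = minus

neg-involutive : ∀ s → neg (neg s) ≡ s
neg-involutive plus  = refl
neg-involutive minus = refl
neg-involutive zer   = refl

neg-·ˡ : ∀ a b → neg a · b ≡ neg (a · b)
neg-·ˡ plus  b = refl
neg-·ˡ minus b = sym (neg-involutive b)
neg-·ˡ zer   b = refl

·-negʳ : ∀ a b → a · neg b ≡ neg (a · b)
·-negʳ plus  b = refl
·-negʳ minus b = refl
·-negʳ zer   b = refl

·-comm : ∀ a b → a · b ≡ b · a
·-comm plus  plus  = refl
·-comm plus  minus = refl
·-comm plus  zer   = refl
·-comm minus plus  = refl
·-comm minus minus = refl
·-comm minus zer   = refl
·-comm zer   plus  = refl
·-comm zer   minus = refl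
·-comm zer   zer   = refl

sgn-·ˡ : ∀ e x y → (sgn e · x) · y ≡ sgn e · (x · y)
sgn-·ˡ false x y = refl
sgn-·ˡ true  x y = neg-·ˡ x y

sgn-·ʳ : ∀ e x y → x · (sgn e · y) ≡ sgn e · (x · y)
sgn-·ʳ false x y = refl
sgn-·ʳ true  x y = ·-negʳ x y

sgn-neg : ∀ e x → sgn e · neg x ≡ neg (sgn e · x)
sgn-neg false x = refl
sgn-neg true  x = refl

sgn-xor : ∀ a b x → sgn (a xor b) · x ≡ sgn a · (sgn b · x)
sgn-xor false b     x = refl
sgn-xor true  false x = refl
sgn-xor true  true  x = sym (neg-involutive x)

sgn-cancel : ∀ e x → sgn e · (sgn e · x) ≡ x
sgn-cancel e x = trans (sym (sgn-xor e e x)) (cong (λ b → sgn b · x) (xor-same e))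

sgn-·-sgn : ∀ a b x y → (sgn a · x) · (sgn b · y) ≡ sgn (a xor b) · (x · y)
sgn-·-sgn a b x y = begin
  (sgn a · x) · (sgn b · y)  ≡⟨ sgn-·ʳ b (sgn a · x) y ⟩
  sgn b · ((sgn a · x) · y)  ≡⟨ cong (sgn b ·_) (sgn-·ˡ a x y) ⟩
  sgn b · (sgn a · (x · y))  ≡⟨ sym (sgn-xor b a (x · y)) ⟩
  sgn (b xor a) · (x · y)    ≡⟨ cong (λ e → sgn e · (x · y)) (xor-comm b a) ⟩
  sgn (a xor b) · (x · y)    ∎
  where open ≡-Reasoning

sgn-·-sgn-same : ∀ e x y → (sgn e · x) · (sgn e · y) ≡ x · y
sgn-·-sgn-same e x y = trans (sgn-·-sgn e e x y) (cong (λ b → sgn b · (x · y)) (xor-same e))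

sgn-nonzero : ∀ e {x} → x ≢ zer → sgn e · x ≢ zer
sgn-nonzero false x≢0 = x≢0
sgn-nonzero true {plus}  _ ()
sgn-nonzero true {minus} _ ()
sgn-nonzero true {zer}   x≢0 _ = x≢0 refl

-- Parity bits, added with xor; the library's commutative-semigroup
-- rearrangements apply to xor as the addition of the Boolean ring.

module XorSemigroup =
  CommutativeSemigroupProperties (CommutativeRing.+-commutativeSemigroup xor-∧-commutativeRing)

xor-absorb : ∀ p s → p xor (p xor s) ≡ s
xor-absorb p s = trans (sym (xor-assoc p p s)) (cong (_xor s) (xor-same p))

xor-cancelʳ : ∀ a t → (a xor t) xor t ≡ a
xor-cancelʳ a t = trans (xor-assoc a t t) (trans (cong (a xor_) (xor-same t)) (xor-identityʳ a))

xor-exchange : ∀ p q a c → (p xor (a xor c)) xor (q xor (c xor a)) ≡ p xor q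
xor-exchange p q a c = begin
  (p xor (a xor c)) xor (q xor (c xor a))  ≡⟨ XorSemigroup.interchange p (a xor c) q (c xor a) ⟩
  (p xor q) xor ((a xor c) xor (c xor a))  ≡⟨ cong (λ d → (p xor q) xor ((a xor c) xor d)) (xor-comm c a) ⟩
  (p xor q) xor ((a xor c) xor (a xor c))  ≡⟨ cong ((p xor q) xor_) (xor-same (a xor c)) ⟩
  (p xor q) xor false                      ≡⟨ xor-identityʳ (p xor q) ⟩
  p xor q                                  ∎
  where open ≡-Reasoning

xorAll : ∀ {r} → Vec Bool r → Bool
xorAll []       = false
xorAll (b ∷ bs) = b xor xorAll bs

xorAll-update : ∀ {r} (bs : Vec Bool r) k b → xorAll (bs [ k ]≔ b) ≡ xorAll bs xor (lookup bs k xor b)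
xorAll-update (x ∷ bs) zero    b = sym (begin
  (x xor xorAll bs) xor (x xor b)  ≡⟨ XorSemigroup.interchange x (xorAll bs) x b ⟩
  (x xor x) xor (xorAll bs xor b)  ≡⟨ cong (_xor (xorAll bs xor b)) (xor-same x) ⟩
  xorAll bs xor b                  ≡⟨ xor-comm (xorAll bs) b ⟩
  b xor xorAll bs                  ∎)
  where open ≡-Reasoning
xorAll-update (x ∷ bs) (suc k) b =
  trans (cong (x xor_) (xorAll-update bs k b)) (sym (xor-assoc x (xorAll bs) (lookup bs k xor b)))

flipSigns : ∀ {r} (bs : Vec Bool r) x →
  foldr (λ _ → Sign) (λ b s → if b then neg s else s) x bs ≡ sgn (xorAll bs) · x
flipSigns []           x = refl
flipSigns (true  ∷ bs) x = trans (cong neg (flipSigns bs x)) (sym (sgn-xor true (xorAll bs) x))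
flipSigns (false ∷ bs) x = flipSigns bs x

vext : ∀ {A : Set} {r} {u v : Vec A r} → (∀ k → lookup u k ≡ lookup v k) → u ≡ v
vext {u = u} {v} h = trans (sym (tabulate∘lookup u)) (trans (tabulate-cong h) (tabulate∘lookup v))

map-swapPos : ∀ {A B : Set} {r} (f : A → B) (v : Vec A r) s t → map f (swapPos v s t) ≡ swapPos (map f v) s t
map-swapPos f v s t = begin
  map f ((v [ s ]≔ lookup v t) [ t ]≔ lookup v s)          ≡⟨ map-[]≔ f (v [ s ]≔ lookup v t) t ⟩
  map f (v [ s ]≔ lookup v t) [ t ]≔ f (lookup v s)        ≡⟨ cong (λ w → w [ t ]≔ f (lookup v s)) (map-[]≔ f v s) ⟩
  (map f v [ s ]≔ f (lookup v t)) [ t ]≔ f (lookup v s)    ≡⟨ cong₂ (λ a b → (map f v [ s ]≔ a) [ t ]≔ b)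
                                                                   (sym (lookup-map t f v)) (sym (lookup-map s f v)) ⟩
  swapPos (map f v) s t                                    ∎
  where open ≡-Reasoning

reindex : ∀ {A : Set} {r} → Vec A r → (Fin r → Fin r) → Vec A r
reindex w f = tabulate λ k → lookup w (f k)

lookup-reindex : ∀ {A : Set} {r} (w : Vec A r) f k → lookup (reindex w f) k ≡ lookup w (f k)
lookup-reindex w f = lookup∘tabulate (λ k → lookup w (f k))

reindex-∘ : ∀ {A : Set} {r} (w : Vec A r) (f g : Fin r → Fin r) → reindex w (λ k → g (f k)) ≡ reindex (reindex w g) f
reindex-∘ w f g = vext λ k →
  trans (lookup-reindex w _ k) (trans (sym (lookup-reindex w g (f k))) (sym (lookup-reindex (reindex w g) f k)))

reindex-cong : ∀ {A : Set} {r} (w : Vec A r) {f g : Fin r → Fin r} → (∀ k → f k ≡ g k) → reindex w f ≡ reindex w g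
reindex-cong w f≗g = tabulate-cong λ k → cong (lookup w) (f≗g k)

reindex-id : ∀ {A : Set} {r} (w : Vec A r) → reindex w (λ k → k) ≡ w
reindex-id w = tabulate∘lookup w

transpose-self : ∀ {r} (i k : Fin r) → PC.transpose i i k ≡ k
transpose-self i k with k ≟ i
... | yes refl = refl
... | no k≢i with k ≟ i
...   | yes k≡i = sym k≡i
...   | no _    = refl

reindex-transpose : ∀ {A : Set} {r} (w : Vec A r) i j → i ≢ j → reindex w (PC.transpose i j) ≡ swapPos w i j
reindex-transpose w i j i≢j = vext λ k → trans (lookup-reindex w _ k) (entry k)
  where
  entry : ∀ k → lookup w (PC.transpose i j k) ≡ lookup (swapPos w i j) k
  entry k with k ≟ i
  ... | yes refl = sym (trans (lookup∘update′ i≢j (w [ k ]≔ lookup w j) (lookup w k)) (lookup∘update k w (lookup w j)))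
  ... | no k≢i with k ≟ j
  ...   | yes refl = sym (lookup∘update k (w [ i ]≔ lookup w k) (lookup w i))
  ...   | no k≢j   = sym (trans (lookup∘update′ k≢j (w [ i ]≔ lookup w j) (lookup w i)) (lookup∘update′ k≢i w (lookup w j)))

map-reindex : ∀ {A B : Set} {r} (h : A → B) (w : Vec A r) f → map h (reindex w f) ≡ reindex (map h w) f
map-reindex h w f = vext λ k → begin
  lookup (map h (reindex w f)) k  ≡⟨ lookup-map k h (reindex w f) ⟩
  h (lookup (reindex w f) k)      ≡⟨ cong h (lookup-reindex w f k) ⟩
  h (lookup w (f k))              ≡⟨ sym (lookup-map (f k) h w) ⟩
  lookup (map h w) (f k)          ≡⟨ sym (lookup-reindex (map h w) f k) ⟩
  lookup (reindex (map h w) f) k  ∎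
  where open ≡-Reasoning

perm-injective : ∀ {r} (π : Permutation′ r) {k l} → π ⟨$⟩ʳ k ≡ π ⟨$⟩ʳ l → k ≡ l
perm-injective π e = trans (sym (inverseˡ π)) (trans (cong (π ⟨$⟩ˡ_) e) (inverseˡ π))

reindex-update : ∀ {A : Set} {r} (w : Vec A r) (π : Permutation′ r) k x →
  reindex w (π ⟨$⟩ʳ_) [ k ]≔ x ≡ reindex (w [ π ⟨$⟩ʳ k ]≔ x) (π ⟨$⟩ʳ_)
reindex-update w π k x = vext entry
  where
  entry : ∀ l → lookup (reindex w (π ⟨$⟩ʳ_) [ k ]≔ x) l ≡ lookup (reindex (w [ π ⟨$⟩ʳ k ]≔ x) (π ⟨$⟩ʳ_)) l
  entry l with l ≟ k
  ... | yes refl = trans (lookup∘update l (reindex w (π ⟨$⟩ʳ_)) x)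
        (sym (trans (lookup-reindex (w [ π ⟨$⟩ʳ l ]≔ x) (π ⟨$⟩ʳ_) l) (lookup∘update (π ⟨$⟩ʳ l) w x)))
  ... | no l≢k = trans (lookup∘update′ l≢k (reindex w (π ⟨$⟩ʳ_)) x) (trans (lookup-reindex w (π ⟨$⟩ʳ_) l)
        (sym (trans (lookup-reindex (w [ π ⟨$⟩ʳ k ]≔ x) (π ⟨$⟩ʳ_) l)
                    (lookup∘update′ (λ e → l≢k (perm-injective π e)) w x))))

sameOM-sym : ∀ {m r} {χ ψ : Chi m r} → SameOM χ ψ → SameOM ψ χ
sameOM-sym (inj₁ χ≗ψ)  = inj₁ λ v → sym (χ≗ψ v)
sameOM-sym (inj₂ χ≗-ψ) = inj₂ λ v → trans (sym (neg-involutive _)) (cong neg (sym (χ≗-ψ v)))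

sameOM-trans : ∀ {m r} {χ ψ ω : Chi m r} → SameOM χ ψ → SameOM ψ ω → SameOM χ ω
sameOM-trans (inj₁ a) (inj₁ b) = inj₁ λ v → trans (a v) (b v)
sameOM-trans (inj₁ a) (inj₂ b) = inj₂ λ v → trans (a v) (b v)
sameOM-trans (inj₂ a) (inj₁ b) = inj₂ λ v → trans (a v) (cong neg (b v))
sameOM-trans (inj₂ a) (inj₂ b) = inj₁ λ v → trans (a v) (trans (cong neg (b v)) (neg-involutive _))

restrict : ∀ {m r} → Chi (suc m) r → Chi m r
restrict χ̂ v = χ̂ (map inject₁ v)

exchangeTerm : ∀ {m k} → Chi m (suc k) → (i j : Vec (Fin m) (suc k)) → Fin (suc k) → Sign
exchangeTerm χ i j s = χ (i [ zero ]≔ lookup j s) · χ (j [ s ]≔ lookup i zero)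

-- Relabelling: σ · M is an oriented matroid, because each axiom for σ · χ
-- at given tuples is the same axiom for χ at the relabelled tuples.

permute-gp : ∀ {m} r (σ : Permutation′ m) (χ : Chi m r) → GP r χ → GP r (permute σ χ)
permute-gp zero    σ χ gp = gp
permute-gp {m} (suc k) σ χ gp i j h = gp (map f i) (map f j) λ s → subst NonNeg (relabelled-term s) (h s)
  where
  f : Fin m → Fin m
  f = σ ⟨$⟩ʳ_
  relabel-update : ∀ (u w : Vec (Fin m) (suc k)) a b → map f (u [ a ]≔ lookup w b) ≡ map f u [ a ]≔ lookup (map f w) b
  relabel-update u w a b = trans (map-[]≔ f u a) (cong (map f u [ a ]≔_) (sym (lookup-map b f w)))
  relabelled-term : ∀ s → exchangeTerm (permute σ χ) i j s ≡ exchangeTerm χ (map f i) (map f j) s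
  relabelled-term s = cong₂ (λ a b → χ a · χ b) (relabel-update i j zero s) (relabel-update j i s zero)

permute-isChirotope : ∀ {m r} (σ : Permutation′ m) (χ : Chi m r) → IsChirotope χ → IsChirotope (permute σ χ)
permute-isChirotope {m} {r} σ χ ch = record
  { notIdZero   = nonzero (IsChirotope.notIdZero ch)
  ; alternating = λ v s t s≢t → trans (cong χ (map-swapPos (σ ⟨$⟩ʳ_) v s t)) (IsChirotope.alternating ch _ s t s≢t)
  ; gp          = permute-gp r σ χ (IsChirotope.gp ch)
  }
  where
  unrelabel : ∀ (v : Vec (Fin m) r) → map (σ ⟨$⟩ʳ_) (map (σ ⟨$⟩ˡ_) v) ≡ v
  unrelabel v = trans (sym (map-∘ (σ ⟨$⟩ʳ_) (σ ⟨$⟩ˡ_) v)) (trans (map-cong (λ _ → inverseʳ σ) v) (map-id v))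
  nonzero : NotIdZero χ → NotIdZero (permute σ χ)
  nonzero (v , χv≢0) = map (σ ⟨$⟩ˡ_) v , subst (λ w → χ w ≢ zer) (sym (unrelabel v)) χv≢0

sameOM-permute : ∀ {m r} (σ : Permutation′ m) {χ ψ : Chi m r} → SameOM χ ψ → SameOM (permute σ χ) (permute σ ψ)
sameOM-permute σ (inj₁ χ≗ψ)  = inj₁ λ v → χ≗ψ (map (σ ⟨$⟩ʳ_) v)
sameOM-permute σ (inj₂ χ≗-ψ) = inj₂ λ v → χ≗-ψ (map (σ ⟨$⟩ʳ_) v)

-- In rank ≥ 1 the Grassmann–Plücker relations also hold with all signs
-- reversed: exchange the first two entries of j (in rank 1, the two factors).
gp-reversed : ∀ {m k} (χ : Chi m (suc k)) → Alternating χ → GP (suc k) χ → ∀ i j →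
  (∀ s → NonNeg (neg (exchangeTerm χ i j s))) → NonNeg (neg (χ i · χ j))
gp-reversed {k = zero} χ alt gp (i₀ ∷ []) (j₀ ∷ []) h =
  subst (λ x → NonNeg (neg x)) (·-comm (χ (j₀ ∷ [])) (χ (i₀ ∷ []))) (h zero)
gp-reversed {k = suc k} χ alt gp (i₀ ∷ is) (j₀ ∷ j₁ ∷ js) h =
  subst NonNeg (swapped (i₀ ∷ is) (j₀ ∷ j₁ ∷ js)) (gp (i₀ ∷ is) (j₁ ∷ j₀ ∷ js) h′)
  where
  swapped : ∀ w w′ → χ w · χ (swapPos w′ zero (suc zero)) ≡ neg (χ w · χ w′)
  swapped w w′ = trans (cong (χ w ·_) (alt w′ zero (suc zero) (λ ()))) (·-negʳ (χ w) (χ w′))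
  -- the s-th term for j₁ j₀ js is minus a term for j₀ j₁ js (with 0 and 1 exchanged)
  h′ : ∀ s → NonNeg (exchangeTerm χ (i₀ ∷ is) (j₁ ∷ j₀ ∷ js) s)
  h′ zero          = subst NonNeg (sym (swapped (j₁ ∷ is) (j₀ ∷ i₀ ∷ js))) (h (suc zero))
  h′ (suc zero)    = subst NonNeg (sym (swapped (j₀ ∷ is) (i₀ ∷ j₁ ∷ js))) (h zero)
  h′ (suc (suc t)) = subst NonNeg (sym (swapped (lookup js t ∷ is) (j₀ ∷ j₁ ∷ (js [ t ]≔ i₀)))) (h (suc (suc t)))

-- It is an oriented matroid: in each Grassmann–Plücker relation all
-- terms and the conclusion acquire the same sign, and for the sign − the
-- relation is the reversed one.

module Reorientation {m} (A : Fin m → Bool) where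

  parityIn : ∀ {r} → Vec (Fin m) r → Bool
  parityIn v = xorAll (map A v)

  reorient-sgn : ∀ {r} (χ : Chi m r) v → reorient A χ v ≡ sgn (parityIn v) · χ v
  reorient-sgn χ v = flipSigns (map A v) (χ v)

  parityIn-update : ∀ {r} (v : Vec (Fin m) r) k x → parityIn (v [ k ]≔ x) ≡ parityIn v xor (A (lookup v k) xor A x)
  parityIn-update v k x = begin
    xorAll (map A (v [ k ]≔ x))                  ≡⟨ cong xorAll (map-[]≔ A v k) ⟩
    xorAll (map A v [ k ]≔ A x)                  ≡⟨ xorAll-update (map A v) k (A x) ⟩
    parityIn v xor (lookup (map A v) k xor A x)  ≡⟨ cong (λ a → parityIn v xor (a xor A x)) (lookup-map k A v) ⟩
    parityIn v xor (A (lookup v k) xor A x)      ∎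
    where open ≡-Reasoning

  parityIn-swap : ∀ {r} (v : Vec (Fin m) r) s t → s ≢ t → parityIn (swapPos v s t) ≡ parityIn v
  parityIn-swap v s t s≢t = begin
    parityIn ((v [ s ]≔ lookup v t) [ t ]≔ lookup v s)
      ≡⟨ parityIn-update (v [ s ]≔ lookup v t) t (lookup v s) ⟩
    parityIn (v [ s ]≔ lookup v t) xor (A (lookup (v [ s ]≔ lookup v t) t) xor A (lookup v s))
      ≡⟨ cong₂ (λ p a → p xor (A a xor A (lookup v s)))
               (parityIn-update v s (lookup v t)) (lookup∘update′ (λ t≡s → s≢t (sym t≡s)) v (lookup v t)) ⟩
    (parityIn v xor (A (lookup v s) xor A (lookup v t))) xor (A (lookup v t) xor A (lookup v s))
      ≡⟨ xor-exchange (parityIn v) false (A (lookup v s)) (A (lookup v t)) ⟩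
    parityIn v xor false
      ≡⟨ xor-identityʳ (parityIn v) ⟩
    parityIn v ∎
    where open ≡-Reasoning

  parityIn-exchange : ∀ {k} (i j : Vec (Fin m) (suc k)) s →
    parityIn (i [ zero ]≔ lookup j s) xor parityIn (j [ s ]≔ lookup i zero) ≡ parityIn i xor parityIn j
  parityIn-exchange i j s =
    trans (cong₂ _xor_ (parityIn-update i zero (lookup j s)) (parityIn-update j s (lookup i zero)))
          (xor-exchange (parityIn i) (parityIn j) (A (lookup i zero)) (A (lookup j s)))

  reorient-pair : ∀ {r} (χ : Chi m r) u w →
    reorient A χ u · reorient A χ w ≡ sgn (parityIn u xor parityIn w) · (χ u · χ w)
  reorient-pair χ u w = trans (cong₂ _·_ (reorient-sgn χ u) (reorient-sgn χ w)) (sgn-·-sgn (parityIn u) (parityIn w) (χ u) (χ w))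

  reorient-gp : ∀ r (χ : Chi m r) → Alternating χ → GP r χ → GP r (reorient A χ)
  reorient-gp zero    χ alt gp = gp
  reorient-gp (suc k) χ alt gp i j h =
    subst NonNeg (sym (reorient-pair χ i j)) (signed (parityIn i xor parityIn j) λ s → subst NonNeg (signed-term s) (h s))
    where
    signed-term : ∀ s → exchangeTerm (reorient A χ) i j s ≡ sgn (parityIn i xor parityIn j) · exchangeTerm χ i j s
    signed-term s = trans (reorient-pair χ (i [ zero ]≔ lookup j s) (j [ s ]≔ lookup i zero))
                          (cong (λ e → sgn e · exchangeTerm χ i j s) (parityIn-exchange i j s))
    signed : ∀ e → (∀ s → NonNeg (sgn e · exchangeTerm χ i j s)) → NonNeg (sgn e · (χ i · χ j))
    signed false = gp i j
    signed true  = gp-reversed χ alt gp i j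

  reorient-isChirotope : ∀ {r} (χ : Chi m r) → IsChirotope χ → IsChirotope (reorient A χ)
  reorient-isChirotope {r} χ ch = record
    { notIdZero   = nonzero (IsChirotope.notIdZero ch)
    ; alternating = alternating
    ; gp          = reorient-gp r χ alt (IsChirotope.gp ch)
    }
    where
    alt = IsChirotope.alternating ch
    nonzero : NotIdZero χ → NotIdZero (reorient A χ)
    nonzero (v , χv≢0) = v , subst (_≢ zer) (sym (reorient-sgn χ v)) (sgn-nonzero (parityIn v) χv≢0)
    alternating : Alternating (reorient A χ)
    alternating v s t s≢t = begin
      reorient A χ (swapPos v s t)                      ≡⟨ reorient-sgn χ (swapPos v s t) ⟩
      sgn (parityIn (swapPos v s t)) · χ (swapPos v s t) ≡⟨ cong₂ (λ p x → sgn p · x) (parityIn-swap v s t s≢t) (alt v s t s≢t) ⟩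
      sgn (parityIn v) · neg (χ v)                      ≡⟨ sgn-neg (parityIn v) (χ v) ⟩
      neg (sgn (parityIn v) · χ v)                      ≡⟨ cong neg (sym (reorient-sgn χ v)) ⟩
      neg (reorient A χ v)                              ∎
      where open ≡-Reasoning

  sameOM-reorient : ∀ {r} {χ ψ : Chi m r} → SameOM χ ψ → SameOM (reorient A χ) (reorient A ψ)
  sameOM-reorient {χ = χ} {ψ} (inj₁ χ≗ψ) = inj₁ λ v →
    trans (reorient-sgn χ v) (trans (cong (sgn (parityIn v) ·_) (χ≗ψ v)) (sym (reorient-sgn ψ v)))
  sameOM-reorient {χ = χ} {ψ} (inj₂ χ≗-ψ) = inj₂ λ v →
    trans (reorient-sgn χ v) (trans (cong (sgn (parityIn v) ·_) (χ≗-ψ v))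
      (trans (sgn-neg (parityIn v) (ψ v)) (cong neg (sym (reorient-sgn ψ v)))))

-- Permuting the positions of a tuple multiplies an alternating map by a
-- fixed sign: first for composites of transpositions, then for any
-- permutation through its decomposition into transpositions.

transpositionsSign : ∀ {m r} (χ : Chi m r) → Alternating χ → (ts : TranspositionList r) →
  Σ Bool λ ε → ∀ w → χ (reindex w (eval ts ⟨$⟩ʳ_)) ≡ sgn ε · χ w
transpositionsSign χ alt [] = false , λ w → cong χ (reindex-id w)
transpositionsSign χ alt ((i , j) ∷ ts) with transpositionsSign χ alt ts
... | ε , χ∘ts with i ≟ j
...   | yes refl = ε , λ w → trans (cong χ (trans (reindex-∘ w (PC.transpose i i) (eval ts ⟨$⟩ʳ_))
          (trans (reindex-cong (reindex w (eval ts ⟨$⟩ʳ_)) (transpose-self i)) (reindex-id (reindex w (eval ts ⟨$⟩ʳ_)))))) (χ∘ts w)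
...   | no i≢j = not ε , λ w → begin
          χ (reindex w (λ k → eval ts ⟨$⟩ʳ PC.transpose i j k))
            ≡⟨ cong χ (trans (reindex-∘ w (PC.transpose i j) (eval ts ⟨$⟩ʳ_)) (reindex-transpose _ i j i≢j)) ⟩
          χ (swapPos (reindex w (eval ts ⟨$⟩ʳ_)) i j)  ≡⟨ alt _ i j i≢j ⟩
          neg (χ (reindex w (eval ts ⟨$⟩ʳ_)))           ≡⟨ cong neg (χ∘ts w) ⟩
          neg (sgn ε · χ w)                            ≡⟨ sym (sgn-xor true ε (χ w)) ⟩
          sgn (not ε) · χ w                            ∎
  where open ≡-Reasoning

positionSign : ∀ {m r} (χ : Chi m r) → Alternating χ → (π : Permutation′ r) →
  Σ Bool λ ε → ∀ w → χ (reindex w (π ⟨$⟩ʳ_)) ≡ sgn ε · χ w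
positionSign χ alt π with transpositionsSign χ alt (decompose π)
... | ε , χ∘π = ε , λ w → trans (cong χ (reindex-cong w λ k → sym (eval-decompose π k))) (χ∘π w)

-- The ground set [2n] as the n pairs {j, j̄}: `pair j false` is j and
-- `pair j true` is j̄.  The complementary basis of a vertex B picks from
-- the j-th pair according to whether j ∈ B.

module Pairs (n : ℕ) where

  pair : Fin n → Bool → Fin (n + n)
  pair j b = if b then n ↑ʳ j else j ↑ˡ n

  index : Fin (n + n) → Fin n
  index x = [ (λ j → j) , (λ j → j) ]′ (splitAt n x)

  side : Fin (n + n) → Bool
  side x = [ (λ _ → false) , (λ _ → true) ]′ (splitAt n x)

  index-pair : ∀ j b → index (pair j b) ≡ j
  index-pair j false = cong [ (λ j → j) , (λ j → j) ]′ (splitAt-↑ˡ n j n)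
  index-pair j true  = cong [ (λ j → j) , (λ j → j) ]′ (splitAt-↑ʳ n n j)

  pair-index-side : ∀ x → pair (index x) (side x) ≡ x
  pair-index-side x = trans (fromSplit (splitAt n x)) (join-splitAt n n x)
    where
    fromSplit : ∀ s → pair ([ (λ j → j) , (λ j → j) ]′ s) ([ (λ _ → false) , (λ _ → true) ]′ s) ≡ join n n s
    fromSplit (inj₁ j) = refl
    fromSplit (inj₂ j) = refl

  bar-pair : ∀ j b → bar {n} (pair j b) ≡ pair j (not b)
  bar-pair j false rewrite splitAt-↑ˡ n j n = refl
  bar-pair j true  rewrite splitAt-↑ʳ n n j = refl

  pair-symmetric : (A : Fin (n + n) → Bool) → (∀ x → A (bar {n} x) ≡ A x) → ∀ j b → A (pair j b) ≡ A (pair j false)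
  pair-symmetric A A-bar j false = refl
  pair-symmetric A A-bar j true  = trans (cong A (sym (bar-pair j false))) (A-bar (pair j false))

  lookup-cobase : ∀ (B : Vertex n) j → lookup (cobase B) j ≡ pair j (lookup B j)
  lookup-cobase B j = lookup∘tabulate (λ j → pair j (lookup B j)) j

  cobase-update : ∀ (B : Vertex n) i b → cobase (B [ i ]≔ b) ≡ cobase B [ i ]≔ pair i b
  cobase-update B i b = vext entry
    where
    entry : ∀ j → lookup (cobase (B [ i ]≔ b)) j ≡ lookup (cobase B [ i ]≔ pair i b) j
    entry j with j ≟ i
    ... | yes refl = trans (lookup-cobase (B [ j ]≔ b) j)
                       (trans (cong (pair j) (lookup∘update j B b)) (sym (lookup∘update j (cobase B) (pair j b))))
    ... | no j≢i   = trans (lookup-cobase (B [ i ]≔ b) j) (trans (cong (pair j) (lookup∘update′ j≢i B b))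
                       (trans (sym (lookup-cobase B j)) (sym (lookup∘update′ j≢i (cobase B) (pair i b)))))

  cobase-self : ∀ (B : Vertex n) i → cobase B [ i ]≔ pair i (lookup B i) ≡ cobase B
  cobase-self B i = trans (cong (cobase B [ i ]≔_) (sym (lookup-cobase B i))) ([]≔-lookup (cobase B) i)

extendBy : ∀ {m} {A : Set} → (Fin m → A) → A → Fin (suc m) → A
extendBy f a x with view x
... | ‵fromℕ        = a
... | ‵inj₁ {i = y} _ = f y

extendBy-old : ∀ {m} {A : Set} (f : Fin m → A) a y → extendBy f a (inject₁ y) ≡ f y
extendBy-old f a y rewrite view-inject₁ y = refl

extendBy-new : ∀ {m} {A : Set} (f : Fin m → A) a → extendBy f a (fromℕ m) ≡ a
extendBy-new {m} f a rewrite view-fromℕ m = refl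

fixNew : ∀ {m} → (Fin m → Fin m) → Fin (suc m) → Fin (suc m)
fixNew {m} f = extendBy (λ y → inject₁ (f y)) (fromℕ m)

fixNew-inverse : ∀ {m} (f g : Fin m → Fin m) → (∀ y → f (g y) ≡ y) → ∀ x → fixNew f (fixNew g x) ≡ x
fixNew-inverse {m} f g f∘g x = byView (view x)
  where
  f̂ ĝ : Fin m → Fin (suc m)
  f̂ y = inject₁ (f y)
  ĝ y = inject₁ (g y)
  byView : ∀ {x} → View x → fixNew f (fixNew g x) ≡ x
  byView ‵fromℕ          = trans (cong (fixNew f) (extendBy-new ĝ (fromℕ m))) (extendBy-new f̂ (fromℕ m))
  byView (‵inj₁ {i = y} _) =
    trans (cong (fixNew f) (extendBy-old ĝ (fromℕ m) y)) (trans (extendBy-old f̂ (fromℕ m) (g y)) (cong inject₁ (f∘g y)))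

extendPerm : ∀ {m} → Permutation′ m → Permutation′ (suc m)
extendPerm σ = Perm.permutation (fixNew (σ ⟨$⟩ʳ_)) (fixNew (σ ⟨$⟩ˡ_))
  (fixNew-inverse _ _ λ _ → inverseʳ σ) (fixNew-inverse _ _ λ _ → inverseˡ σ)

map-fixNew : ∀ {m r} (f : Fin m → Fin m) (v : Vec (Fin m) r) → map (fixNew f) (map inject₁ v) ≡ map inject₁ (map f v)
map-fixNew f v = trans (sym (map-∘ (fixNew f) inject₁ v)) (trans (map-cong (extendBy-old _ _) v) (map-∘ inject₁ f v))

restrict-permute : ∀ {m r} (σ : Permutation′ m) (χ̂ : Chi (suc m) r) v →
  restrict (permute (extendPerm σ) χ̂) v ≡ permute σ (restrict χ̂) v
restrict-permute σ χ̂ v = cong χ̂ (map-fixNew (σ ⟨$⟩ʳ_) v)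

restrict-reorient : ∀ {m r} (A : Fin m → Bool) (χ̂ : Chi (suc m) r) v →
  restrict (reorient (extendBy A false) χ̂) v ≡ reorient A (restrict χ̂) v
restrict-reorient A χ̂ v = cong (foldr (λ _ → Sign) (λ b s → if b then neg s else s) (χ̂ (map inject₁ v)))
  (trans (sym (map-∘ (extendBy A false) inject₁ v)) (map-cong (extendBy-old A false) v))

flipAt-same : ∀ {n} (B : Vertex n) i → lookup (flipAt B i) i ≡ not (lookup B i)
flipAt-same B i = lookup∘update i B (not (lookup B i))

flipAt-other : ∀ {n} (B : Vertex n) {i j} → j ≢ i → lookup (flipAt B i) j ≡ lookup B j
flipAt-other B {i} j≢i = lookup∘update′ j≢i B (not (lookup B i))

flipAt-injective : ∀ {n} (B : Vertex n) i k → flipAt B i ≡ flipAt B k → i ≡ k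
flipAt-injective B i k e with i ≟ k
... | yes i≡k = i≡k
... | no  i≢k = ⊥-elim (not-¬ refl (sym (trans (sym (flipAt-same B i)) (trans (cong (λ C → lookup C i) e) (flipAt-other B i≢k)))))

flipAt-involutive : ∀ {n} (B : Vertex n) i → flipAt (flipAt B i) i ≡ B
flipAt-involutive B i = vext entry
  where
  entry : ∀ j → lookup (flipAt (flipAt B i) i) j ≡ lookup B j
  entry j with j ≟ i
  ... | yes refl = trans (flipAt-same (flipAt B j) j) (trans (cong not (flipAt-same B j)) (not-involutive (lookup B j)))
  ... | no  j≢i  = trans (flipAt-other (flipAt B i) j≢i) (flipAt-other B j≢i)

flipAt-sym : ∀ {n} {B C : Vertex n} {i} → C ≡ flipAt B i → B ≡ flipAt C i
flipAt-sym {B = B} {i = i} refl = sym (flipAt-involutive B i)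

EdgeSign : ℕ → Set
EdgeSign n = Vertex n → Fin n → Sign

arcsOf : ∀ {n} → EdgeSign n → Orientation n
arcsOf P B C = ∃ λ i → C ≡ flipAt B i × P B i ≡ minus

Antisymmetric : ∀ {n} → EdgeSign n → Set
Antisymmetric P = ∀ B i → P (flipAt B i) i ≡ neg (P B i)

twist : ∀ {n} → (Fin n → Bool) → EdgeSign n → EdgeSign n
twist S P B i = sgn (S i) · P B i

twist-antisymmetric : ∀ {n} (S : Fin n → Bool) {P : EdgeSign n} → Antisymmetric P → Antisymmetric (twist S P)
twist-antisymmetric S {P} anti B i = trans (cong (sgn (S i) ·_) (anti B i)) (sgn-neg (S i) (P B i))

across : ∀ {n} {P : EdgeSign n} → Antisymmetric P → ∀ {B C i} → C ≡ flipAt B i → P C i ≡ neg (P B i)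
across anti {B} {i = i} refl = anti B i

arcsOf-cong : ∀ {n} {P Q : EdgeSign n} → (∀ B i → P B i ≡ Q B i) → ∀ B C → arcsOf P B C ⇔ arcsOf Q B C
arcsOf-cong P≗Q B C = mk⇔ (λ { (i , e , p) → i , e , trans (sym (P≗Q B i)) p })
                          (λ { (i , e , q) → i , e , trans (P≗Q B i) q })

facetSwitch-cong : ∀ {n} (j : Fin n) {O O′ : Orientation n} → (∀ B C → O B C ⇔ O′ B C) →
  ∀ B C → facetSwitch j O B C ⇔ facetSwitch j O′ B C
facetSwitch-cong j O≅O′ B C = mk⇔
  (λ { (inj₁ (e , o)) → inj₁ (e , Equivalence.to (O≅O′ C B) o) ; (inj₂ (e , o)) → inj₂ (e , Equivalence.to (O≅O′ B C) o) })
  (λ { (inj₁ (e , o)) → inj₁ (e , Equivalence.from (O≅O′ C B) o) ; (inj₂ (e , o)) → inj₂ (e , Equivalence.from (O≅O′ B C) o) })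

twistAt-self : ∀ {n} (j : Fin n) x → sgn (does (j ≟ j)) · x ≡ neg x
twistAt-self j x = cong (λ b → sgn b · x) (dec-true (j ≟ j) refl)

twistAt-other : ∀ {n} {i j : Fin n} → i ≢ j → ∀ x → sgn (does (i ≟ j)) · x ≡ x
twistAt-other {i = i} {j} i≢j x = cong (λ b → sgn b · x) (dec-false (i ≟ j) i≢j)

facetSwitch-arcsOf : ∀ {n} {P : EdgeSign n} → Antisymmetric P → ∀ j B C →
  facetSwitch j (arcsOf P) B C ⇔ arcsOf (twist (λ i → does (i ≟ j)) P) B C
facetSwitch-arcsOf {P = P} anti j B C = mk⇔ switched unswitched
  where
  switched : facetSwitch j (arcsOf P) B C → arcsOf (twist (λ i → does (i ≟ j)) P) B C
  switched (inj₁ (C≡Bj , k , B≡Ck , PCk)) with flipAt-injective C k j (trans (sym B≡Ck) (flipAt-sym C≡Bj))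
  ... | refl = k , C≡Bj , trans (twistAt-self k (P B k)) (trans (sym (across anti C≡Bj)) PCk)
  switched (inj₂ (C≢Bj , k , C≡Bk , PBk)) = k , C≡Bk , trans (twistAt-other k≢j (P B k)) PBk
    where
    k≢j : k ≢ j
    k≢j refl = C≢Bj C≡Bk
  unswitched : arcsOf (twist (λ i → does (i ≟ j)) P) B C → facetSwitch j (arcsOf P) B C
  -- deciding k ≟ j turns the twisted sign into −P B k, respectively P B k
  unswitched (k , C≡Bk , twisted) with k ≟ j
  ... | yes refl = inj₁ (C≡Bk , k , flipAt-sym C≡Bk , trans (across anti C≡Bk) twisted)
  ... | no  k≢j  = inj₂ ((λ C≡Bj → k≢j (flipAt-injective B k j (trans (sym C≡Bk) C≡Bj))) , k , C≡Bk , twisted)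

parity : ∀ {n} → List (Fin n) → Fin n → Bool
parity []       i = false
parity (j ∷ js) i = does (i ≟ j) xor parity js i

facetSwitches-arcsOf : ∀ {n} {P : EdgeSign n} → Antisymmetric P → ∀ js B C →
  facetSwitches js (arcsOf P) B C ⇔ arcsOf (twist (parity js) P) B C
facetSwitches-arcsOf anti []       B C = ⇔-id _
facetSwitches-arcsOf {P = P} anti (j ∷ js) B C =
  arcsOf-cong (λ B′ i → sym (sgn-xor (does (i ≟ j)) (parity js i) (P B′ i))) B C
    ⇔-∘ (facetSwitch-arcsOf (twist-antisymmetric (parity js) anti) j B C
    ⇔-∘ facetSwitch-cong j (facetSwitches-arcsOf anti js) B C)

listOf : ∀ {n} → (Fin n → Bool) → List (Fin n)
listOf {zero}  S = []
listOf {suc n} S = if S zero then zero ∷ later else later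
  where later = List.map suc (listOf (λ i → S (suc i)))

parity-map-suc-zero : ∀ {n} (js : List (Fin n)) → parity (List.map suc js) zero ≡ false
parity-map-suc-zero []       = refl
parity-map-suc-zero (j ∷ js) = parity-map-suc-zero js

parity-map-suc-suc : ∀ {n} (js : List (Fin n)) i → parity (List.map suc js) (suc i) ≡ parity js i
parity-map-suc-suc []       i = refl
parity-map-suc-suc (j ∷ js) i = cong (does (i ≟ j) xor_) (parity-map-suc-suc js i)

parity-listOf : ∀ {n} (S : Fin n → Bool) i → parity (listOf S) i ≡ S i
parity-listOf {suc n} S i with S zero in S₀
parity-listOf {suc n} S zero    | true  = trans (cong not (parity-map-suc-zero (listOf (λ i → S (suc i))))) (sym S₀)
parity-listOf {suc n} S zero    | false = trans (parity-map-suc-zero (listOf (λ i → S (suc i)))) (sym S₀)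
parity-listOf {suc n} S (suc i) | true  =
  trans (parity-map-suc-suc (listOf (λ i → S (suc i))) i) (parity-listOf (λ i → S (suc i)) i)
parity-listOf {suc n} S (suc i) | false =
  trans (parity-map-suc-suc (listOf (λ i → S (suc i))) i) (parity-listOf (λ i → S (suc i)) i)

-- The induced orientation of χ̂ is arcsOf (edgeSign χ̂) by definition.

basisOf : ∀ {n} → Vertex n → Vec (Fin (suc (n + n))) n
basisOf B = map inject₁ (cobase B)

edgeSign : ∀ {n} → Chi (suc (n + n)) n → EdgeSign n
edgeSign {n} χ̂ B i = χ̂ (basisOf B) · χ̂ (basisOf B [ i ]≔ newElt n)

sameOM-neg : ∀ {m r} {χ ψ : Chi m r} → SameOM χ ψ → ∀ {u w} → ψ u ≡ neg (ψ w) → χ u ≡ neg (χ w)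
sameOM-neg (inj₁ χ≗ψ)  {u} {w} h = trans (χ≗ψ u) (trans h (cong neg (sym (χ≗ψ w))))
sameOM-neg (inj₂ χ≗-ψ) {u} {w} h = trans (χ≗-ψ u) (trans (cong neg h) (cong neg (sym (χ≗-ψ w))))

pmatroid-flip : ∀ {n} {χ : Chi (n + n) n} → IsPMatroid {n} χ → ∀ B i → χ (cobase (flipAt B i)) ≡ neg (χ (cobase B))
pmatroid-flip {n} {χ} pm B i = begin
  χ (cobase (flipAt B i))                         ≡⟨ cong χ (cobase-update B i (not (lookup B i))) ⟩
  χ (cobase B [ i ]≔ pair i (not (lookup B i)))  ≡⟨ exchange (lookup B i) ⟩
  neg (χ (cobase B [ i ]≔ pair i (lookup B i)))  ≡⟨ cong (λ v → neg (χ v)) (cobase-self B i) ⟩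
  neg (χ (cobase B))                              ∎
  where
  open Pairs n
  open ≡-Reasoning
  exchange : ∀ b → χ (cobase B [ i ]≔ pair i (not b)) ≡ neg (χ (cobase B [ i ]≔ pair i b))
  exchange true  = proj₁ (proj₂ pm B i)
  exchange false = trans (sym (neg-involutive _)) (cong neg (sym (proj₁ (proj₂ pm B i))))

edgeSign-antisymmetric : ∀ {n} {χ : Chi (n + n) n} {χ̂ : Chi (suc (n + n)) n} →
  IsPMatroid {n} χ → Extends {n} χ̂ χ → Antisymmetric (edgeSign χ̂)
edgeSign-antisymmetric {n} {χ} {χ̂} pm ext B i = begin
  χ̂ (basisOf (flipAt B i)) · χ̂ (basisOf (flipAt B i) [ i ]≔ newElt n)
    ≡⟨ cong₂ _·_ (sameOM-neg ext (pmatroid-flip pm B i)) (cong χ̂ same-neighbour) ⟩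
  neg (χ̂ (basisOf B)) · χ̂ (basisOf B [ i ]≔ newElt n)
    ≡⟨ neg-·ˡ (χ̂ (basisOf B)) _ ⟩
  neg (edgeSign χ̂ B i) ∎
  where
  open Pairs n
  open ≡-Reasoning
  -- B and B ⊕ {i} differ only at position i, which is overwritten
  same-neighbour : basisOf (flipAt B i) [ i ]≔ newElt n ≡ basisOf B [ i ]≔ newElt n
  same-neighbour = begin
    map inject₁ (cobase (flipAt B i)) [ i ]≔ newElt n
      ≡⟨ cong (λ v → map inject₁ v [ i ]≔ newElt n) (cobase-update B i (not (lookup B i))) ⟩
    map inject₁ (cobase B [ i ]≔ pair i (not (lookup B i))) [ i ]≔ newElt n
      ≡⟨ cong (_[ i ]≔ newElt n) (map-[]≔ inject₁ (cobase B) i) ⟩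
    (map inject₁ (cobase B) [ i ]≔ inject₁ (pair i (not (lookup B i)))) [ i ]≔ newElt n
      ≡⟨ []≔-idempotent (map inject₁ (cobase B)) i ⟩
    map inject₁ (cobase B) [ i ]≔ newElt n ∎

-- Reorienting M̂ on a bar-symmetric set A of old elements extends
-- _{-A}M and multiplies the edge signs of the directions i ∈ A by −1; for
-- a P-matroid the facet switches in those directions undo this twist.
reoriented-extension : ∀ {n} (χ : Chi (n + n) n) (χ̂ : Chi (suc (n + n)) n) →
  IsPMatroid {n} χ → IsChirotope χ̂ → Extends {n} χ̂ χ →
  ∀ (ψ : Chi (n + n) n) → FSEquivalent {n} ψ χ →
  Σ (Chi (suc (n + n)) n) λ ψ̂ → IsChirotope ψ̂ × Extends {n} ψ̂ ψ ×
    Σ (List (Fin n)) λ is → SameOrientation (facetSwitches is (induced {n} ψ̂)) (induced {n} χ̂)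
reoriented-extension {n} χ χ̂ pm ch ext ψ (A , A-bar , ψ≈Aχ) =
  ψ̂ , reorient-isChirotope χ̂ ch , extends , listOf S , switched
  where
  open Pairs n
  open ≡-Reasoning
  Â : Fin (suc (n + n)) → Bool
  Â = extendBy A false
  open Reorientation Â

  ψ̂ : Chi (suc (n + n)) n
  ψ̂ = reorient Â χ̂

  S : Fin n → Bool
  S i = A (pair i false)

  extends : Extends {n} ψ̂ ψ
  extends = sameOM-trans (inj₁ (restrict-reorient A χ̂))
              (sameOM-trans (Reorientation.sameOM-reorient A ext) (sameOM-sym ψ≈Aχ))

  -- of the complementary basis of B, only bᵢ leaves when 2n+1 enters, and bᵢ ∈ A iff i ∈ S
  twisted-edges : ∀ B i → edgeSign ψ̂ B i ≡ twist S (edgeSign χ̂) B i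
  twisted-edges B i = begin
    reorient Â χ̂ u · reorient Â χ̂ (u [ i ]≔ newElt n)                      ≡⟨ reorient-pair χ̂ u (u [ i ]≔ newElt n) ⟩
    sgn (parityIn u xor parityIn (u [ i ]≔ newElt n)) · edgeSign χ̂ B i   ≡⟨ cong (λ e → sgn e · edgeSign χ̂ B i) parity-change ⟩
    sgn (S i) · edgeSign χ̂ B i                                             ∎
    where
    u = basisOf B
    leaving : Â (lookup u i) ≡ S i
    leaving = begin
      Â (lookup (map inject₁ (cobase B)) i)  ≡⟨ cong Â (lookup-map i inject₁ (cobase B)) ⟩
      Â (inject₁ (lookup (cobase B) i))      ≡⟨ extendBy-old A false (lookup (cobase B) i) ⟩
      A (lookup (cobase B) i)                ≡⟨ cong A (lookup-cobase B i) ⟩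
      A (pair i (lookup B i))                ≡⟨ pair-symmetric A A-bar i (lookup B i) ⟩
      S i                                    ∎
    parity-change : parityIn u xor parityIn (u [ i ]≔ newElt n) ≡ S i
    parity-change = begin
      parityIn u xor parityIn (u [ i ]≔ newElt n)                         ≡⟨ cong (parityIn u xor_) (parityIn-update u i (newElt n)) ⟩
      parityIn u xor (parityIn u xor (Â (lookup u i) xor Â (newElt n)))  ≡⟨ xor-absorb (parityIn u) _ ⟩
      Â (lookup u i) xor Â (newElt n)                                     ≡⟨ cong₂ _xor_ leaving (extendBy-new A false) ⟩
      S i xor false                                                       ≡⟨ xor-identityʳ (S i) ⟩
      S i                                                                 ∎

  ψ̂-antisymmetric : Antisymmetric (edgeSign ψ̂)
  ψ̂-antisymmetric B i = begin
    edgeSign ψ̂ (flipAt B i) i            ≡⟨ twisted-edges (flipAt B i) i ⟩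
    twist S (edgeSign χ̂) (flipAt B i) i  ≡⟨ twist-antisymmetric S (edgeSign-antisymmetric {χ̂ = χ̂} pm ext) B i ⟩
    neg (twist S (edgeSign χ̂) B i)       ≡⟨ cong neg (sym (twisted-edges B i)) ⟩
    neg (edgeSign ψ̂ B i)                 ∎

  untwist : ∀ B i → twist (parity (listOf S)) (edgeSign ψ̂) B i ≡ edgeSign χ̂ B i
  untwist B i = begin
    sgn (parity (listOf S) i) · edgeSign ψ̂ B i  ≡⟨ cong₂ (λ e x → sgn e · x) (parity-listOf S i) (twisted-edges B i) ⟩
    sgn (S i) · (sgn (S i) · edgeSign χ̂ B i)    ≡⟨ sgn-cancel (S i) (edgeSign χ̂ B i) ⟩
    edgeSign χ̂ B i                              ∎

  switched : SameOrientation (facetSwitches (listOf S) (induced {n} ψ̂)) (induced {n} χ̂)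
  switched B C = arcsOf-cong untwist B C ⇔-∘ facetSwitches-arcsOf ψ̂-antisymmetric (listOf S) B C

-- A bar-compatible permutation σ of [2n] maps the pair {j, j̄} onto the pair
-- {π j, π j̄}, keeping or exchanging its elements according to a bit τ j.

pairImage : ∀ {n} → Permutation′ (n + n) → Fin n → Fin n
pairImage {n} σ j = Pairs.index n (σ ⟨$⟩ʳ Pairs.pair n j false)

pairTwist : ∀ {n} → Permutation′ (n + n) → Fin n → Bool
pairTwist {n} σ j = Pairs.side n (σ ⟨$⟩ʳ Pairs.pair n j false)

module _ {n : ℕ} where
  open Pairs n

  σ-pair : ∀ (σ : Permutation′ (n + n)) → BarCompatible {n} σ → ∀ j b →
    σ ⟨$⟩ʳ pair j b ≡ pair (pairImage σ j) (b xor pairTwist σ j)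
  σ-pair σ bc j false = sym (pair-index-side (σ ⟨$⟩ʳ pair j false))
  σ-pair σ bc j true  = begin
    σ ⟨$⟩ʳ pair j true                                  ≡⟨ cong (σ ⟨$⟩ʳ_) (sym (bar-pair j false)) ⟩
    σ ⟨$⟩ʳ bar {n} (pair j false)                        ≡⟨ bc (pair j false) ⟩
    bar {n} (σ ⟨$⟩ʳ pair j false)                        ≡⟨ cong (bar {n}) (sym (pair-index-side _)) ⟩
    bar {n} (pair (pairImage σ j) (pairTwist σ j))      ≡⟨ bar-pair (pairImage σ j) (pairTwist σ j) ⟩
    pair (pairImage σ j) (not (pairTwist σ j))          ∎
    where open ≡-Reasoning

  barCompatible-inverse : ∀ (σ : Permutation′ (n + n)) → BarCompatible {n} σ → BarCompatible {n} (Perm.flip σ)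
  barCompatible-inverse σ bc x = begin
    σ ⟨$⟩ˡ bar {n} x                          ≡⟨ cong (λ y → σ ⟨$⟩ˡ bar {n} y) (sym (inverseʳ σ)) ⟩
    σ ⟨$⟩ˡ bar {n} (σ ⟨$⟩ʳ (σ ⟨$⟩ˡ x))        ≡⟨ cong (σ ⟨$⟩ˡ_) (sym (bc (σ ⟨$⟩ˡ x))) ⟩
    σ ⟨$⟩ˡ (σ ⟨$⟩ʳ bar {n} (σ ⟨$⟩ˡ x))        ≡⟨ inverseˡ σ ⟩
    bar {n} (σ ⟨$⟩ˡ x)                        ∎
    where open ≡-Reasoning

  pairImage-inverse : ∀ (σ τ : Permutation′ (n + n)) → BarCompatible {n} σ → BarCompatible {n} τ →
    (∀ x → τ ⟨$⟩ʳ (σ ⟨$⟩ʳ x) ≡ x) → ∀ j → pairImage τ (pairImage σ j) ≡ j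
  pairImage-inverse σ τ bσ bτ τ∘σ j = begin
    pairImage τ k                                         ≡⟨ sym (index-pair (pairImage τ k) (t xor pairTwist τ k)) ⟩
    index (pair (pairImage τ k) (t xor pairTwist τ k))    ≡⟨ cong index (sym (σ-pair τ bτ k t)) ⟩
    index (τ ⟨$⟩ʳ pair k t)                               ≡⟨ cong (λ x → index (τ ⟨$⟩ʳ x)) (sym (σ-pair σ bσ j false)) ⟩
    index (τ ⟨$⟩ʳ (σ ⟨$⟩ʳ pair j false))                  ≡⟨ cong index (τ∘σ (pair j false)) ⟩
    index (pair j false)                                  ≡⟨ index-pair j false ⟩
    j                                                     ∎
    where
    open ≡-Reasoning
    k = pairImage σ j
    t = pairTwist σ j

  pairPermutation : ∀ (σ : Permutation′ (n + n)) → BarCompatible {n} σ → Permutation′ n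
  pairPermutation σ bc = Perm.permutation (pairImage σ) (pairImage (Perm.flip σ))
    (pairImage-inverse (Perm.flip σ) σ (barCompatible-inverse σ bc) bc λ _ → inverseʳ σ)
    (pairImage-inverse σ (Perm.flip σ) bc (barCompatible-inverse σ bc) λ _ → inverseˡ σ)

module SignedCoordinatePermutation {n} (π : Permutation′ n) (τ : Fin n → Bool) where

  act : Vertex n → Vertex n
  act B = tabulate λ k → lookup B (π ⟨$⟩ˡ k) xor τ (π ⟨$⟩ˡ k)

  unact : Vertex n → Vertex n
  unact C = tabulate λ j → lookup C (π ⟨$⟩ʳ j) xor τ j

  lookup-act : ∀ B j → lookup (act B) (π ⟨$⟩ʳ j) ≡ lookup B j xor τ j
  lookup-act B j = trans (lookup∘tabulate (λ k → lookup B (π ⟨$⟩ˡ k) xor τ (π ⟨$⟩ˡ k)) (π ⟨$⟩ʳ j))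
                         (cong (λ l → lookup B l xor τ l) (inverseˡ π))

  -- every position is π j for some j
  vext-π : ∀ {u v : Vertex n} → (∀ j → lookup u (π ⟨$⟩ʳ j) ≡ lookup v (π ⟨$⟩ʳ j)) → u ≡ v
  vext-π {u} {v} h = vext λ k → subst (λ l → lookup u l ≡ lookup v l) (inverseʳ π) (h (π ⟨$⟩ˡ k))

  unact-act : ∀ B → unact (act B) ≡ B
  unact-act B = vext λ j → trans (lookup∘tabulate (λ j → lookup (act B) (π ⟨$⟩ʳ j) xor τ j) j)
    (trans (cong (_xor τ j) (lookup-act B j)) (xor-cancelʳ (lookup B j) (τ j)))

  act-unact : ∀ C → act (unact C) ≡ C
  act-unact C = vext-π λ j → trans (lookup-act (unact C) j)
    (trans (cong (_xor τ j) (lookup∘tabulate (λ j → lookup C (π ⟨$⟩ʳ j) xor τ j) j)) (xor-cancelʳ (lookup C (π ⟨$⟩ʳ j)) (τ j)))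

  act-flipAt : ∀ B i → act (flipAt B i) ≡ flipAt (act B) (π ⟨$⟩ʳ i)
  act-flipAt B i = vext-π entry
    where
    entry : ∀ j → lookup (act (flipAt B i)) (π ⟨$⟩ʳ j) ≡ lookup (flipAt (act B) (π ⟨$⟩ʳ i)) (π ⟨$⟩ʳ j)
    entry j with j ≟ i
    ... | yes refl = trans (lookup-act (flipAt B j) j) (trans (cong (_xor τ j) (flipAt-same B j))
                       (sym (trans (flipAt-same (act B) (π ⟨$⟩ʳ j))
                         (trans (cong not (lookup-act B j)) (not-distribˡ-xor (lookup B j) (τ j))))))
    ... | no  j≢i  = trans (lookup-act (flipAt B i) j) (trans (cong (_xor τ j) (flipAt-other B j≢i))
                       (sym (trans (flipAt-other (act B) (λ e → j≢i (perm-injective π e))) (lookup-act B j))))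

  act-injective : ∀ {B C} → act B ≡ act C → B ≡ C
  act-injective {B} {C} e = trans (sym (unact-act B)) (trans (cong unact e) (unact-act C))

  neighbour-preimage : ∀ {B C k} → act C ≡ flipAt (act B) k → C ≡ flipAt B (π ⟨$⟩ˡ k)
  neighbour-preimage {B} {C} {k} e =
    act-injective (trans e (trans (cong (flipAt (act B)) (sym (inverseʳ π))) (sym (act-flipAt B (π ⟨$⟩ˡ k)))))

  automorphism : CubeAutomorphism n
  automorphism = record
    { bij      = mk↔ₛ′ act unact act-unact unact-act
    ; adjacent = λ B C → mk⇔ (λ { (i , e) → π ⟨$⟩ʳ i , trans (cong act e) (act-flipAt B i) })
                             (λ { (k , e) → π ⟨$⟩ˡ k , neighbour-preimage e })
    }

  arcsOf-transport : ∀ {P Q : EdgeSign n} → (∀ B i → P B i ≡ Q (act B) (π ⟨$⟩ʳ i)) →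
    ∀ B C → arcsOf P B C ⇔ arcsOf Q (act B) (act C)
  arcsOf-transport {P} {Q} P≗Q B C = mk⇔
    (λ { (i , e , p) → π ⟨$⟩ʳ i , trans (cong act e) (act-flipAt B i) , trans (sym (P≗Q B i)) p })
    (λ { (k , e , q) → π ⟨$⟩ˡ k , neighbour-preimage e ,
                       trans (P≗Q B (π ⟨$⟩ˡ k)) (subst (λ l → Q (act B) l ≡ minus) (sym (inverseʳ π)) q) })

-- Relabelling M̂ by σ extended with σ(2n+1) = 2n+1 extends σ·M;
-- σ maps the complementary basis of B onto that of φ(B) for the signed
-- coordinate permutation φ of σ, up to a permutation of positions, whose
-- sign cancels in each edge sign.  So φ carries one orientation onto the other.
relabelled-extension : ∀ {n} (χ : Chi (n + n) n) (χ̂ : Chi (suc (n + n)) n) →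
  IsChirotope χ̂ → Extends {n} χ̂ χ →
  ∀ (ψ : Chi (n + n) n) → CEquivalent {n} ψ χ →
  Σ (Chi (suc (n + n)) n) λ ψ̂ → IsChirotope ψ̂ × Extends {n} ψ̂ ψ × Isomorphic (induced {n} ψ̂) (induced {n} χ̂)
relabelled-extension {n} χ χ̂ ch ext ψ (σ , bc , ψ≈σχ) =
  ψ̂ , permute-isChirotope σ̂ χ̂ ch , extends , automorphism , arcsOf-transport {P = edgeSign ψ̂} {Q = edgeSign χ̂} transported-edges
  where
  open Pairs n
  open ≡-Reasoning
  π : Permutation′ n
  π = pairPermutation σ bc
  open SignedCoordinatePermutation π (pairTwist σ)

  σ̂ : Permutation′ (suc (n + n))
  σ̂ = extendPerm σ

  ψ̂ : Chi (suc (n + n)) n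
  ψ̂ = permute σ̂ χ̂

  extends : Extends {n} ψ̂ ψ
  extends = sameOM-trans (inj₁ (restrict-permute σ χ̂)) (sameOM-trans (sameOM-permute σ ext) (sameOM-sym ψ≈σχ))

  relabelled-cobase : ∀ B → map (σ ⟨$⟩ʳ_) (cobase B) ≡ reindex (cobase (act B)) (π ⟨$⟩ʳ_)
  relabelled-cobase B = vext λ j → begin
    lookup (map (σ ⟨$⟩ʳ_) (cobase B)) j           ≡⟨ lookup-map j (σ ⟨$⟩ʳ_) (cobase B) ⟩
    σ ⟨$⟩ʳ lookup (cobase B) j                     ≡⟨ cong (σ ⟨$⟩ʳ_) (lookup-cobase B j) ⟩
    σ ⟨$⟩ʳ pair j (lookup B j)                     ≡⟨ σ-pair σ bc j (lookup B j) ⟩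
    pair (π ⟨$⟩ʳ j) (lookup B j xor pairTwist σ j) ≡⟨ cong (pair (π ⟨$⟩ʳ j)) (sym (lookup-act B j)) ⟩
    pair (π ⟨$⟩ʳ j) (lookup (act B) (π ⟨$⟩ʳ j))    ≡⟨ sym (lookup-cobase (act B) (π ⟨$⟩ʳ j)) ⟩
    lookup (cobase (act B)) (π ⟨$⟩ʳ j)             ≡⟨ sym (lookup-reindex (cobase (act B)) (π ⟨$⟩ʳ_) j) ⟩
    lookup (reindex (cobase (act B)) (π ⟨$⟩ʳ_)) j  ∎

  relabelled-basis : ∀ B → map (σ̂ ⟨$⟩ʳ_) (basisOf B) ≡ reindex (basisOf (act B)) (π ⟨$⟩ʳ_)
  relabelled-basis B = trans (map-fixNew (σ ⟨$⟩ʳ_) (cobase B))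
    (trans (cong (map inject₁) (relabelled-cobase B)) (map-reindex inject₁ (cobase (act B)) (π ⟨$⟩ʳ_)))

  relabelled-neighbour : ∀ B i →
    map (σ̂ ⟨$⟩ʳ_) (basisOf B [ i ]≔ newElt n) ≡ reindex (basisOf (act B) [ π ⟨$⟩ʳ i ]≔ newElt n) (π ⟨$⟩ʳ_)
  relabelled-neighbour B i = begin
    map (σ̂ ⟨$⟩ʳ_) (basisOf B [ i ]≔ newElt n)                      ≡⟨ map-[]≔ (σ̂ ⟨$⟩ʳ_) (basisOf B) i ⟩
    map (σ̂ ⟨$⟩ʳ_) (basisOf B) [ i ]≔ (σ̂ ⟨$⟩ʳ newElt n)          ≡⟨ cong₂ (_[ i ]≔_) (relabelled-basis B)
                                                                        (extendBy-new (λ y → inject₁ (σ ⟨$⟩ʳ y)) (newElt n)) ⟩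
    reindex (basisOf (act B)) (π ⟨$⟩ʳ_) [ i ]≔ newElt n            ≡⟨ reindex-update (basisOf (act B)) π i (newElt n) ⟩
    reindex (basisOf (act B) [ π ⟨$⟩ʳ i ]≔ newElt n) (π ⟨$⟩ʳ_)     ∎

  ε : Bool
  ε = proj₁ (positionSign χ̂ (IsChirotope.alternating ch) π)

  χ̂∘π : ∀ w → χ̂ (reindex w (π ⟨$⟩ʳ_)) ≡ sgn ε · χ̂ w
  χ̂∘π = proj₂ (positionSign χ̂ (IsChirotope.alternating ch) π)

  transported-edges : ∀ B i → edgeSign ψ̂ B i ≡ edgeSign χ̂ (act B) (π ⟨$⟩ʳ i)
  transported-edges B i = begin
    χ̂ (map (σ̂ ⟨$⟩ʳ_) (basisOf B)) · χ̂ (map (σ̂ ⟨$⟩ʳ_) (basisOf B [ i ]≔ newElt n))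
      ≡⟨ cong₂ _·_ (trans (cong χ̂ (relabelled-basis B)) (χ̂∘π _)) (trans (cong χ̂ (relabelled-neighbour B i)) (χ̂∘π _)) ⟩
    (sgn ε · χ̂ (basisOf (act B))) · (sgn ε · χ̂ (basisOf (act B) [ π ⟨$⟩ʳ i ]≔ newElt n))
      ≡⟨ sgn-·-sgn-same ε _ _ ⟩
    edgeSign χ̂ (act B) (π ⟨$⟩ʳ i) ∎

mainTheorem5 : ∀ (n : ℕ) (χ : Chi (n + n) n) (χ̂ : Chi (suc (n + n)) n) →
    IsPMatroid {n} χ → IsChirotope χ̂ → Extends {n} χ̂ χ → Nondegenerate {n} χ̂ →
    (∀ (ψ : Chi (n + n) n) → IsChirotope ψ → CEquivalent {n} ψ χ →
       Σ (Chi (suc (n + n)) n) λ ψ̂ → IsChirotope ψ̂ × Extends {n} ψ̂ ψ ×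
         Isomorphic (induced {n} ψ̂) (induced {n} χ̂))
    ×
    (∀ (ψ : Chi (n + n) n) → IsChirotope ψ → FSEquivalent {n} ψ χ →
       Σ (Chi (suc (n + n)) n) λ ψ̂ → IsChirotope ψ̂ × Extends {n} ψ̂ ψ ×
         Σ (List (Fin n)) λ is → SameOrientation (facetSwitches is (induced {n} ψ̂)) (induced {n} χ̂))
mainTheorem5 n χ χ̂ pm ch ext _ =
  (λ ψ _ → relabelled-extension χ χ̂ ch ext ψ) ,
  (λ ψ _ → reoriented-extension χ χ̂ pm ch ext ψ)
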